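{- Let $A$ be a set of actions containing $\tau$, $(S,\to)$ a labelled transition system with labels from $A$, and $R$ any binary relation on $S$. Then the stuttering closure $\hat R$ has the stuttering property: whenever $t_0\xrightarrow{\tau}t_1\xrightarrow{\tau}\cdots\xrightarrow{\tau}t_n$, $s\hat Rt_0$ and $s\hat Rt_n$, then $s\hat Rt_i$ for all $i=0,\dots,n$.
   Context: $s\xrightarrow{a}s'$ means $(s,a,s')\in\to$; $\twoheadrightarrow$ is the reflexive–transitive closure of $\xrightarrow{\tau}$. The stuttering closure of $R$ is $\hat R=\{(s,t)\mid\exists s^-,s^+,t^-,t^+\in S.\ s^-\twoheadrightarrow s\twoheadrightarrow s^+,\ t^-\twoheadrightarrow t\twoheadrightarrow t^+,\ s^-Rt^+,\ s^+Rt^-\}$. -}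

module Defs where

open import Data.Product using (Σ; _×_; _,_; ∃-syntax)
open import Relation.Binary.Construct.Closure.ReflexiveTransitive using (Star)

LTS : Set → Set → Set₁
LTS S A = S → A → S → Set

Rel₂ : Set → Set₁
Rel₂ S = S → S → Set

τStep : {S A : Set} → LTS S A → A → Rel₂ S
τStep T τ s s' = T s τ s'

τStar : {S A : Set} → LTS S A → A → Rel₂ S
τStar T τ = Star (τStep T τ)

StutterClosure : {S A : Set} → LTS S A → A → Rel₂ S → Rel₂ S
StutterClosure {S} T τ R s t =
  ∃[ s⁻ ] ∃[ s⁺ ] ∃[ t⁻ ] ∃[ t⁺ ]
    ( τStar T τ s⁻ s × τStar T τ s s⁺
    × τStar T τ t⁻ t × τStar T τ t t⁺
    × R s⁻ t⁺ × R s⁺ t⁻ )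

-- Keep the witnesses s⁻, s⁺ of the closure at t₀ together with t⁻ from there, and take t⁺
-- from the closure at tₙ: every tᵢ lies on the τ-path t⁻ ↠ t₀ ↠ tᵢ ↠ tₙ ↠ t⁺.
module Submission where

open import Defs
open import Data.Nat using (ℕ; suc; zero)
open import Data.Fin using (Fin; inject₁; fromℕ)
open import Data.Fin using () renaming (suc to fsuc; zero to fzero)
open import Data.Product using (_,_)
open import Relation.Binary.Construct.Closure.ReflexiveTransitive using (Star; ε; _◅_; _◅◅_)

module _ {S : Set} {_⟶_ : S → S → Set} where

  IsPath : (n : ℕ) → (Fin (suc n) → S) → Set
  IsPath n t = (i : Fin n) → t (inject₁ i) ⟶ t (fsuc i)

  path-from-start : ∀ n {t : Fin (suc n) → S} → IsPath n t →
                    (i : Fin (suc n)) → Star _⟶_ (t fzero) (t i)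
  path-from-start n       path fzero    = ε
  path-from-start (suc n) path (fsuc i) =
    path-from-start n (λ j → path (inject₁ j)) i ◅◅ (path i ◅ ε)

  path-to-end : ∀ n {t : Fin (suc n) → S} → IsPath n t →
                (i : Fin (suc n)) → Star _⟶_ (t i) (t (fromℕ n))
  path-to-end zero        path fzero    = ε
  path-to-end (suc n) {t} path fzero    =
    path fzero ◅ path-to-end n {λ j → t (fsuc j)} (λ j → path (fsuc j)) fzero
  path-to-end (suc n) {t} path (fsuc i) =
    path-to-end n {λ j → t (fsuc j)} (λ j → path (fsuc j)) i

module _ {S A : Set} (T : LTS S A) (τ : A) (R : Rel₂ S) where

  StutterClosure-between : ∀ {s t₀ t t₁} →
    StutterClosure T τ R s t₀ → StutterClosure T τ R s t₁ →
    τStar T τ t₀ t → τStar T τ t t₁ → StutterClosure T τ R s t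
  StutterClosure-between
    (s⁻ , s⁺ , t₀⁻ , _ , s⁻↠s , s↠s⁺ , t₀⁻↠t₀ , _ , _ , s⁺Rt₀⁻)
    (s⁻′ , _ , _ , t₁⁺ , s⁻′↠s , _ , _ , t₁↠t₁⁺ , s⁻′Rt₁⁺ , _) t₀↠t t↠t₁ =
    s⁻′ , s⁺ , t₀⁻ , t₁⁺ , s⁻′↠s , s↠s⁺ , t₀⁻↠t₀ ◅◅ t₀↠t , t↠t₁ ◅◅ t₁↠t₁⁺ , s⁻′Rt₁⁺ , s⁺Rt₀⁻

lemma6 : (A : Set) (τ : A) (S : Set) (T : LTS S A) (R : Rel₂ S)
    → (n : ℕ) (t : Fin (suc n) → S)
    → ((i : Fin n) → T (t (inject₁ i)) τ (t (fsuc i)))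
    → (s : S)
    → StutterClosure T τ R s (t fzero)
    → StutterClosure T τ R s (t (fromℕ n))
    → (i : Fin (suc n)) → StutterClosure T τ R s (t i)
lemma6 A τ S T R n t path s sR̂t₀ sR̂tₙ i =
  StutterClosure-between T τ R sR̂t₀ sR̂tₙ (path-from-start n path i) (path-to-end n path i)
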